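{- For any natural numbers $i,q,s,k$, there are at most $N_i(q,s,k)$ pairwise non-l-isomorphic rooted $k$-labelled trees of height at most $i$ that are $f$-reduced for the threshold function $f(j)=R_j(q,s,k)$.
   Context: Trees are finite, rooted, with unordered children; a rooted $k$-labelled tree has each node carrying a subset of $k$ labels. Height is the largest root-to-node distance (a single node has height $0$); in a tree of height $h$ a node is at level $\ell$ if its distance from the root is $h-\ell$. A limb of a node $v$ is the subtree formed by a child of $v$ and all its descendants. Two rooted labelled trees are l-isomorphic if some isomorphism preserves the root and all labels. For $f:\mathbb N\to\mathbb N$: if $v$ is a node at level $i+1>0$ and $B$ is a limb of $v$ with at least $f(i)$ other limbs of $v$ l-isomorphic to $B$, then the tree $f$-reduces in one step to $T-V(B)$; a tree is $f$-reduced if no such step applies. Define $N_0(q,s,k)=2^k+1$, $R_i(q,s,k)=q\cdot N_i(q,s,k)^s$, $N_{i+1}(q,s,k)=2^k\cdot(R_i(q,s,k)+1)^{N_i(q,s,k)}$. -}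

module Defs where

open import Data.Nat using (ℕ; zero; suc; _+_; _*_; _∸_; _^_; _⊔_)
open import Data.Fin using (Fin)
open import Data.Fin.Subset using (Subset)
open import Data.List using (List; []; _∷_; length; lookup)
open import Data.Product using (Σ; _×_)
open import Relation.Binary.PropositionalEquality using (_≡_; _≢_)
open import Relation.Nullary using (¬_)
open import Function.Bundles using (_↔_; Inverse)
open import Function.Definitions using (Injective)

-- Rooted k-labelled trees: each node carries a subset of the k labels and a
-- finite collection of children (order irrelevant up to l-isomorphism).
data Tree (k : ℕ) : Set where
  node : Subset k → List (Tree k) → Tree k

children : ∀ {k} → Tree k → List (Tree k)
children (node _ cs) = cs

mutual
  height : ∀ {k} → Tree k → ℕ
  height (node _ cs) = heightList cs

  heightList : ∀ {k} → List (Tree k) → ℕ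
  heightList [] = 0
  heightList (c ∷ cs) = suc (height c) ⊔ heightList cs

data _≅_ {k : ℕ} : Tree k → Tree k → Set where
  iso : ∀ {L L' : Subset k} {cs ds : List (Tree k)} → L ≡ L' →
        (σ : Fin (length cs) ↔ Fin (length ds)) →
        (∀ j → lookup cs j ≅ lookup ds (Inverse.to σ j)) →
        node L cs ≅ node L' ds

-- NodeAt d T v : v is (the subtree rooted at) a node of T at distance d from the root
data NodeAt {k : ℕ} : ℕ → Tree k → Tree k → Set where
  here  : ∀ {t} → NodeAt 0 t t
  there : ∀ {L cs d v} (j : Fin (length cs)) →
          NodeAt d (lookup cs j) v → NodeAt (suc d) (node L cs) v

AtLeastOtherIsoLimbs : ∀ {k} (m : ℕ) (cs : List (Tree k)) → Fin (length cs) → Set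
AtLeastOtherIsoLimbs m cs j =
  Σ (Fin m → Fin (length cs)) λ g → Injective _≡_ _≡_ g ×
    (∀ x → (g x ≢ j) × (lookup cs (g x) ≅ lookup cs j))

-- T is f-reduced: no f-reduction step applies. A node at distance d from the
-- root of T has level (height T ∸ d); a node with a limb has level i+1 > 0
-- with i = height T ∸ d ∸ 1.
Reduced : ∀ {k} → (ℕ → ℕ) → Tree k → Set
Reduced f T = ∀ d L cs → NodeAt d T (node L cs) → (j : Fin (length cs)) →
  ¬ AtLeastOtherIsoLimbs (f (height T ∸ d ∸ 1)) cs j

N : ℕ → ℕ → ℕ → ℕ → ℕ
N zero q s k = 2 ^ k + 1
N (suc i) q s k = 2 ^ k * (q * N i q s k ^ s + 1) ^ N i q s k

R : ℕ → ℕ → ℕ → ℕ → ℕ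
R i q s k = q * N i q s k ^ s

-- The limbs of an f-reduced tree of height at most i + 1
-- are f-reduced of height at most i, so by induction they fall into at most m = N_i
-- l-isomorphism classes, and a class occurs at most R_i times among the limbs of the root.
-- A tree is therefore determined up to l-isomorphism by its root label and the vector of
-- multiplicities of the classes of its limbs, which takes at most 2^k (R_i + 1)^m values.
-- Since R_j is nondecreasing in j, reducedness relative to a tree's own height implies
-- reducedness when levels are counted from any larger height bound, which is the form the
-- induction needs. Choosing class representatives needs excluded middle for l-isomorphism,
-- so it happens under a double negation, which the decidable conclusion absorbs.
module Submission where

open import Defs
open import Algebra.Properties.CommutativeSemigroup using (x∙yz≈y∙xz)
open import Data.Empty using (⊥; ⊥-elim)
open import Data.Fin using (Fin; zero; suc; punchIn; lift; combine; fromℕ<; inject≤; _≟_)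
open import Data.Fin.Permutation using (Permutation; _⟨$⟩ʳ_; _⟨$⟩ˡ_; inverseʳ; insert; insert-punchIn)
import Data.Fin.Permutation as Perm
open import Data.Fin.Properties
  using (2↔Bool; ¬Fin0; 0≢1+n; suc-injective; lift-injective; combine-injective; fromℕ<-injective;
         inject≤-injective; injective⇒≤)
open import Data.Fin.Subset using (Subset)
open import Data.List using (List; []; _∷_; length; lookup)
open import Data.List.Membership.Propositional.Properties using (∈-lookup)
open import Data.List.Relation.Unary.All using (All; []; _∷_)
import Data.List.Relation.Unary.All as All
open import Data.Nat
  using (ℕ; zero; suc; _+_; _*_; _∸_; _^_; _≤_; _<_; _≤′_; ≤′-refl; ≤′-step; z≤n; s≤s; s≤s⁻¹; _≤?_; >-nonZero)
open import Data.Nat.Properties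
  using (≤-refl; ≤-reflexive; ≤-trans; <⇒≤; <⇒≢; ≰⇒>; ≤⇒≤′; m≤m+n; m≤n+m; m≤n*m;
         +-comm; +-cancelˡ-≡;
         +-mono-≤; +-monoˡ-≤; *-mono-≤; *-monoʳ-≤; *-identityʳ; ^-monoˡ-≤; ^-monoʳ-≤; m^n>0; m^n≢0;
         ∸-monoˡ-≤; m⊔n≤o⇒m≤o; m⊔n≤o⇒n≤o; +-commutativeSemigroup)
import Data.Nat.Properties as ℕ
open import Data.Product using (Σ; _×_; _,_; proj₁; proj₂)
import Data.Vec as Vec
open import Data.Vec.Properties using (tabulate∘lookup; tabulate-cong)
open import Effect.Monad using (RawMonad)
open import Function using (_∘_; Inverse)
open import Function.Construct.Composition using (_↔-∘_)
open import Function.Construct.Symmetry using (↔-sym)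
open import Function.Definitions using (Injective)
open import Level using (0ℓ)
open import Relation.Binary using (_Preserves_⟶_)
open import Relation.Binary.PropositionalEquality
open import Relation.Nullary using (¬_; Dec; yes; no; contradiction)
open import Relation.Nullary.Decidable using (decidable-stable; ¬¬-excluded-middle)
open import Relation.Nullary.Negation using (¬¬-Monad)

open RawMonad (¬¬-Monad {a = 0ℓ}) using (pure; _>>=_; _<$>_)

indicator : ∀ {m} → Fin m → Fin m → ℕ
indicator a j with a ≟ j
... | yes _ = 1
... | no  _ = 0

indicator-refl : ∀ {m} (j : Fin m) → indicator j j ≡ 1
indicator-refl j with j ≟ j
... | yes _   = refl
... | no  j≢j = contradiction refl j≢j

count : ∀ {n m} → (Fin n → Fin m) → Fin m → ℕ
count {zero}  f j = 0
count {suc n} f j = indicator (f zero) j + count (f ∘ suc) j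

count-punchIn : ∀ {n m} (f : Fin (suc n) → Fin m) y j →
  count f j ≡ indicator (f y) j + count (f ∘ punchIn y) j
count-punchIn f zero j = refl
count-punchIn {suc n} f (suc y) j =
  trans (cong (indicator (f zero) j +_) (count-punchIn (f ∘ suc) y j))
        (x∙yz≈y∙xz +-commutativeSemigroup (indicator (f zero) j) (indicator (f (suc y)) j) _)

count-head>0 : ∀ {n m} (f : Fin (suc n) → Fin m) → 0 < count f (f zero)
count-head>0 f rewrite indicator-refl (f zero) = s≤s z≤n

count≥⇒injection : ∀ {n m} (f : Fin n → Fin m) j r → r ≤ count f j →
  Σ (Fin r → Fin n) λ h → Injective _≡_ _≡_ h × (∀ z → f (h z) ≡ j)
count≥⇒injection f j zero _ = (λ ()) , (λ {x} → contradiction x ¬Fin0) , λ ()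
count≥⇒injection {zero} f j (suc r) ()
count≥⇒injection {suc n} f j (suc r) r≤c with f zero ≟ j
... | yes f0≡j =
  let h , h-inj , h-hits = count≥⇒injection (f ∘ suc) j r (s≤s⁻¹ r≤c)
  in lift 1 h , lift-injective h h-inj 1 , λ { zero → f0≡j ; (suc z) → h-hits z }
... | no _ =
  let h , h-inj , h-hits = count≥⇒injection (f ∘ suc) j (suc r) r≤c
  in suc ∘ h , (λ e → h-inj (suc-injective e)) , h-hits

count>0⇒hit : ∀ {n m} (f : Fin n → Fin m) j → 0 < count f j → Σ (Fin n) λ y → f y ≡ j
count>0⇒hit f j c>0 = let h , _ , h-hits = count≥⇒injection f j 1 c>0 in h zero , h-hits zero

count≡⇒permutation : ∀ {n n' m} (f : Fin n → Fin m) (g : Fin n' → Fin m) →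
  (∀ j → count f j ≡ count g j) → Σ (Permutation n n') λ σ → ∀ x → g (σ ⟨$⟩ʳ x) ≡ f x
count≡⇒permutation {zero} {zero} f g _ = Perm.id , λ ()
count≡⇒permutation {zero} {suc n'} f g same = contradiction (same (g zero)) (<⇒≢ (count-head>0 g))
count≡⇒permutation {suc n} f g same with count>0⇒hit g (f zero) (subst (0 <_) (same (f zero)) (count-head>0 f))
count≡⇒permutation {suc n} {suc n'} f g same | y , gy≡f0 =
  let σ , σ-match = count≡⇒permutation (f ∘ suc) (g ∘ punchIn y) same-rest
  in insert zero y σ , λ { zero → gy≡f0 ; (suc x) → trans (cong g (insert-punchIn zero y σ x)) (σ-match x) }
  where
  open ≡-Reasoning
  same-rest : ∀ j → count (f ∘ suc) j ≡ count (g ∘ punchIn y) j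
  same-rest j = +-cancelˡ-≡ (indicator (f zero) j) _ _ (begin
    count f j                                    ≡⟨ same j ⟩
    count g j                                    ≡⟨ count-punchIn g y j ⟩
    indicator (g y) j + count (g ∘ punchIn y) j  ≡⟨ cong (λ a → indicator a j + _) gy≡f0 ⟩
    indicator (f zero) j + count (g ∘ punchIn y) j ∎)

encodeFun : ∀ {b} m → (Fin m → Fin b) → Fin (b ^ m)
encodeFun zero    f = zero
encodeFun (suc m) f = combine (f zero) (encodeFun m (f ∘ suc))

encodeFun-injective : ∀ {b} m (f g : Fin m → Fin b) → encodeFun m f ≡ encodeFun m g → ∀ x → f x ≡ g x
encodeFun-injective (suc m) f g e x with combine-injective (f zero) _ (g zero) _ e
encodeFun-injective (suc m) f g e zero    | e₀ , _ = e₀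
encodeFun-injective (suc m) f g e (suc x) | _ , e₁ = encodeFun-injective m (f ∘ suc) (g ∘ suc) e₁ x

encodeSubset : ∀ {k} → Subset k → Fin (2 ^ k)
encodeSubset {k} L = encodeFun k (Inverse.from 2↔Bool ∘ Vec.lookup L)

encodeSubset-injective : ∀ {k} (L L' : Subset k) → encodeSubset L ≡ encodeSubset L' → L ≡ L'
encodeSubset-injective {k} L L' e = begin
  L                            ≡⟨ tabulate∘lookup L ⟨
  Vec.tabulate (Vec.lookup L)  ≡⟨ tabulate-cong sameBits ⟩
  Vec.tabulate (Vec.lookup L') ≡⟨ tabulate∘lookup L' ⟩
  L'                           ∎
  where
  open ≡-Reasoning
  open Inverse 2↔Bool using (to; from; strictlyInverseˡ)
  sameBits : ∀ x → Vec.lookup L x ≡ Vec.lookup L' x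
  sameBits x = begin
    Vec.lookup L x              ≡⟨ strictlyInverseˡ _ ⟨
    to (from (Vec.lookup L x))  ≡⟨ cong to (encodeFun-injective k _ _ e x) ⟩
    to (from (Vec.lookup L' x)) ≡⟨ strictlyInverseˡ _ ⟩
    Vec.lookup L' x             ∎

n<2^n : ∀ n → n < 2 ^ n
n<2^n zero    = s≤s z≤n
n<2^n (suc n) = +-mono-≤ (m^n>0 2 n) (≤-trans (n<2^n n) (m≤m+n _ 0))

N>0 : ∀ i q s k → 0 < N i q s k
N>0 zero    q s k = m≤n+m 1 (2 ^ k)
N>0 (suc i) q s k = *-mono-≤ (m^n>0 2 k) (m^n>0 (R i q s k + 1) {{>-nonZero (m≤n+m 1 _)}} (N i q s k))

R>0 : ∀ i q s k → 0 < q → 0 < R i q s k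
R>0 i q s k q>0 = *-mono-≤ q>0 (m^n>0 (N i q s k) {{>-nonZero (N>0 i q s k)}} s)

N≤N-suc : ∀ i q s k → 0 < q → N i q s k ≤ N (suc i) q s k
N≤N-suc i q s k q>0 = begin
  N i q s k                            ≤⟨ <⇒≤ (n<2^n _) ⟩
  2 ^ N i q s k                        ≤⟨ ^-monoˡ-≤ (N i q s k) (+-monoˡ-≤ 1 (R>0 i q s k q>0)) ⟩
  (R i q s k + 1) ^ N i q s k          ≤⟨ m≤n*m _ (2 ^ k) {{m^n≢0 2 k}} ⟩
  2 ^ k * (R i q s k + 1) ^ N i q s k  ∎
  where open ℕ.≤-Reasoning

R≤R-suc : ∀ i q s k → R i q s k ≤ R (suc i) q s k
R≤R-suc i zero      s k = z≤n
R≤R-suc i q@(suc _) s k = *-monoʳ-≤ q (^-monoˡ-≤ s (N≤N-suc i q s k (s≤s z≤n)))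

R-mono : ∀ q s k → (λ i → R i q s k) Preserves _≤_ ⟶ _≤_
R-mono q s k i≤j = go (≤⇒≤′ i≤j)
  where
  go : ∀ {i j} → i ≤′ j → R i q s k ≤ R j q s k
  go ≤′-refl                    = ≤-refl
  go {j = suc j} (≤′-step i≤′j) = ≤-trans (go i≤′j) (R≤R-suc j q s k)

module _ {k : ℕ} where

  label : Tree k → Subset k
  label (node L _) = L

  mutual
    ≅-refl : (t : Tree k) → t ≅ t
    ≅-refl (node L cs) = iso refl Perm.id (≅-refl-lookup cs)

    ≅-refl-lookup : (cs : List (Tree k)) (j : Fin (length cs)) → lookup cs j ≅ lookup cs j
    ≅-refl-lookup (c ∷ cs) zero    = ≅-refl c
    ≅-refl-lookup (c ∷ cs) (suc j) = ≅-refl-lookup cs j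

  ≅-sym : {t u : Tree k} → t ≅ u → u ≅ t
  ≅-sym {node L cs} {node L' ds} (iso L≡L' σ limbs) = iso (sym L≡L') (↔-sym σ) λ j →
    subst (λ x → lookup ds x ≅ lookup cs (σ ⟨$⟩ˡ j)) (inverseʳ σ) (≅-sym (limbs (σ ⟨$⟩ˡ j)))

  ≅-trans : {t u v : Tree k} → t ≅ u → u ≅ v → t ≅ v
  ≅-trans (iso e σ f) (iso e' τ g) = iso (trans e e') (τ ↔-∘ σ) λ j → ≅-trans (f j) (g (σ ⟨$⟩ʳ j))

  PairwiseNonIso : List (Tree k) → Set
  PairwiseNonIso ts = ∀ (a b : Fin (length ts)) → a ≢ b → ¬ (lookup ts a ≅ lookup ts b)

  NonIsoFamily : (Tree k → Set) → List (Tree k) → Set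
  NonIsoFamily P ts = All P ts × PairwiseNonIso ts

  AtMostNonIso : ℕ → (Tree k → Set) → Set
  AtMostNonIso n P = ∀ ts → NonIsoFamily P ts → length ts ≤ n

  AtMostNonIso-mono : ∀ {n n'} {P Q : Tree k → Set} → n ≤ n' → (∀ {t} → Q t → P t) →
    AtMostNonIso n P → AtMostNonIso n' Q
  AtMostNonIso-mono n≤n' Q⇒P bound ts (qs , pw) = ≤-trans (bound ts (All.map Q⇒P qs , pw)) n≤n'

  AllLimbs : (Tree k → Set) → Tree k → Set
  AllLimbs P t = ∀ x → P (lookup (children t) x)

  FewIsoLimbs : ℕ → Tree k → Set
  FewIsoLimbs r t = ∀ j → ¬ AtLeastOtherIsoLimbs r (children t) j

  _∈≅_ : Tree k → List (Tree k) → Set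
  t ∈≅ ys = Σ (Fin (length ys)) λ j → t ≅ lookup ys j

  record _⊑_ (xs ys : List (Tree k)) : Set where
    field
      class   : Fin (length xs) → Fin (length ys)
      class-≅ : ∀ i → lookup xs i ≅ lookup ys (class i)
  open _⊑_

  ∈≅-⊑ : ∀ {t ys zs} → t ∈≅ ys → ys ⊑ zs → t ∈≅ zs
  ∈≅-⊑ (j , t≅) ys⊑zs = class ys⊑zs j , ≅-trans t≅ (class-≅ ys⊑zs j)

  []-⊑ : ∀ {ys} → [] ⊑ ys
  []-⊑ = record { class = λ () ; class-≅ = λ () }

  ∷-⊑ : ∀ {t xs ys} → t ∈≅ ys → xs ⊑ ys → (t ∷ xs) ⊑ ys
  ∷-⊑ (j , t≅) xs⊑ys = record
    { class   = λ { zero → j  ; (suc i) → class xs⊑ys i }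
    ; class-≅ = λ { zero → t≅ ; (suc i) → class-≅ xs⊑ys i }
    }

  ⊑-refl : ∀ {ys} → ys ⊑ ys
  ⊑-refl {ys} = record { class = λ j → j ; class-≅ = ≅-refl ∘ lookup ys }

  ⊑-trans : ∀ {xs ys zs} → xs ⊑ ys → ys ⊑ zs → xs ⊑ zs
  ⊑-trans xs⊑ys ys⊑zs = record
    { class   = class ys⊑zs ∘ class xs⊑ys
    ; class-≅ = λ i → ≅-trans (class-≅ xs⊑ys i) (class-≅ ys⊑zs (class xs⊑ys i))
    }

  ⊑-∷ : ∀ {t ys} → ys ⊑ (t ∷ ys)
  ⊑-∷ {ys = ys} = record { class = suc ; class-≅ = ≅-refl ∘ lookup ys }

  ⊑-class : ∀ {xs ys} (xs⊑ys : xs ⊑ ys) {i j} → class xs⊑ys i ≡ j → lookup xs i ≅ lookup ys j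
  ⊑-class xs⊑ys {i} refl = class-≅ xs⊑ys i

  PairwiseNonIso-∷ : ∀ {t ys} → PairwiseNonIso ys → ¬ t ∈≅ ys → PairwiseNonIso (t ∷ ys)
  PairwiseNonIso-∷ pw t∉ zero    zero    0≢0 _ = 0≢0 refl
  PairwiseNonIso-∷ pw t∉ zero    (suc b) _   t≅ = t∉ (b , t≅)
  PairwiseNonIso-∷ pw t∉ (suc a) zero    _   ≅t = t∉ (a , ≅-sym ≅t)
  PairwiseNonIso-∷ pw t∉ (suc a) (suc b) a≢b = pw a b (a≢b ∘ cong suc)

  insertRepresentative : ∀ {P reps t} → NonIsoFamily P reps → P t →
    ¬ ¬ Σ (List (Tree k)) λ reps' → NonIsoFamily P reps' × reps ⊑ reps' × t ∈≅ reps'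
  insertRepresentative {P} {reps} {t} (ps , pw) pt = choose <$> ¬¬-excluded-middle
    where
    choose : Dec (t ∈≅ reps) → Σ (List (Tree k)) λ reps' → NonIsoFamily P reps' × reps ⊑ reps' × t ∈≅ reps'
    choose (yes t∈) = reps , (ps , pw) , ⊑-refl , t∈
    choose (no  t∉) = t ∷ reps , (pt ∷ ps , PairwiseNonIso-∷ pw t∉) , ⊑-∷ , zero , ≅-refl t

  extendRepresentatives : ∀ {P reps} → NonIsoFamily P reps → ∀ xs → (∀ i → P (lookup xs i)) →
    ¬ ¬ Σ (List (Tree k)) λ reps' → NonIsoFamily P reps' × reps ⊑ reps' × xs ⊑ reps'
  extendRepresentatives fam []       _  = pure (_ , fam , ⊑-refl , []-⊑)
  extendRepresentatives fam (x ∷ xs) ps = do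
    reps₁ , fam₁ , reps⊑reps₁ , x∈ ← insertRepresentative fam (ps zero)
    reps₂ , fam₂ , reps₁⊑reps₂ , xs⊑ ← extendRepresentatives fam₁ xs (ps ∘ suc)
    pure (reps₂ , fam₂ , ⊑-trans reps⊑reps₁ reps₁⊑reps₂ , ∷-⊑ (∈≅-⊑ x∈ reps₁⊑reps₂) xs⊑)

  LimbClasses : (Tree k → Set) → List (Tree k) → Set
  LimbClasses P ts = Σ (List (Tree k)) λ reps → NonIsoFamily P reps × ∀ a → children (lookup ts a) ⊑ reps

  limbRepresentatives : ∀ {P} ts → All (AllLimbs P) ts → ¬ ¬ LimbClasses P ts
  limbRepresentatives []       []         = pure ([] , ([] , λ ()) , λ ())
  limbRepresentatives (t ∷ ts) (pt ∷ pts) = do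
    reps₁ , fam₁ , ts⊑ ← limbRepresentatives ts pts
    reps₂ , fam₂ , reps₁⊑reps₂ , t⊑ ← extendRepresentatives fam₁ (children t) pt
    pure (reps₂ , fam₂ , λ { zero → t⊑ ; (suc a) → ⊑-trans (ts⊑ a) reps₁⊑reps₂ })

  FewIsoLimbs⇒count< : ∀ {r reps} {t : Tree k} (cover : children t ⊑ reps) → FewIsoLimbs r t →
    ∀ j → count (class cover) j < suc r
  FewIsoLimbs⇒count< {r} cover few j with suc r ≤? count (class cover) j
  ... | no  c≱ = ≰⇒> c≱
  ... | yes c≥ =
    let h , h-inj , h-class = count≥⇒injection (class cover) j (suc r) c≥
        sameClass z = ≅-trans (⊑-class cover (h-class (suc z))) (≅-sym (⊑-class cover (h-class zero)))
    in ⊥-elim (few (h zero)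
         (h ∘ suc , (λ e → suc-injective (h-inj e)) , λ z → (0≢1+n ∘ sym ∘ h-inj) , sameClass z))

  ≅-by-limb-classes : ∀ {reps} {t u : Tree k} (ct : children t ⊑ reps) (cu : children u ⊑ reps) →
    label t ≡ label u → (∀ j → count (class ct) j ≡ count (class cu) j) → t ≅ u
  ≅-by-limb-classes {t = node L cs} {node L' ds} ct cu L≡L' same =
    let σ , σ-class = count≡⇒permutation (class ct) (class cu) same
    in iso L≡L' σ λ x → ≅-trans (class-≅ ct x) (≅-sym (⊑-class cu (σ-class x)))

  signature-bound : ∀ {P : Tree k → Set} {r n} → AtMostNonIso n P →
    AtMostNonIso (2 ^ k * suc r ^ n) (λ t → AllLimbs P t × FewIsoLimbs r t)
  signature-bound {P} {r} {n} bound ts (hyps , pw) =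
    decidable-stable (_ ≤? _) (bySignature <$> limbRepresentatives ts (All.map proj₁ hyps))
    where
    bySignature : LimbClasses P ts → length ts ≤ 2 ^ k * suc r ^ n
    bySignature (reps , fam , cover) = begin
      length ts          ≤⟨ injective⇒≤ {f = signature} signature-injective ⟩
      2 ^ k * suc r ^ m  ≤⟨ *-monoʳ-≤ (2 ^ k) (^-monoʳ-≤ (suc r) (bound reps fam)) ⟩
      2 ^ k * suc r ^ n  ∎
      where
      open ℕ.≤-Reasoning
      m = length reps
      count< : ∀ a j → count (class (cover a)) j < suc r
      count< a = FewIsoLimbs⇒count< {t = lookup ts a} (cover a) (proj₂ (All.lookup hyps (∈-lookup a)))
      signature : Fin (length ts) → Fin (2 ^ k * suc r ^ m)
      signature a = combine (encodeSubset (label (lookup ts a))) (encodeFun m (λ j → fromℕ< (count< a j)))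
      signature-injective : Injective _≡_ _≡_ signature
      signature-injective {a} {b} e = decidable-stable (a ≟ b) λ a≢b →
        let sameLabel , sameCounts = combine-injective _ _ _ _ e
        in pw a b a≢b (≅-by-limb-classes (cover a) (cover b)
             (encodeSubset-injective _ _ sameLabel)
             (λ j → fromℕ<-injective _ _ (count< a j) (count< b j) (encodeFun-injective m _ _ sameCounts j)))

  heightList-limb : ∀ (cs : List (Tree k)) {ℓ} → heightList cs ≤ suc ℓ → ∀ x → height (lookup cs x) ≤ ℓ
  heightList-limb (c ∷ cs) h zero    = s≤s⁻¹ (m⊔n≤o⇒m≤o (suc (height c)) (heightList cs) h)
  heightList-limb (c ∷ cs) h (suc x) = heightList-limb cs (m⊔n≤o⇒n≤o (suc (height c)) (heightList cs) h) x

  -- A node at distance d from the root has level ℓ ∸ d, where ℓ bounds the height of T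
  -- (Reduced f T is the case ℓ = height T).
  ReducedAtHeight : (ℕ → ℕ) → ℕ → Tree k → Set
  ReducedAtHeight f ℓ T = ∀ d L cs → NodeAt d T (node L cs) → (j : Fin (length cs)) →
    ¬ AtLeastOtherIsoLimbs (f (ℓ ∸ d ∸ 1)) cs j

  ReducedHeight≤ : (ℕ → ℕ) → ℕ → Tree k → Set
  ReducedHeight≤ f ℓ t = height t ≤ ℓ × ReducedAtHeight f ℓ t

  AtLeastOtherIsoLimbs-weaken : ∀ {m m'} (cs : List (Tree k)) (j : Fin (length cs)) → m' ≤ m →
    AtLeastOtherIsoLimbs m cs j → AtLeastOtherIsoLimbs m' cs j
  AtLeastOtherIsoLimbs-weaken cs j m'≤m (g , g-inj , g-iso) =
    g ∘ shrink , (λ e → inject≤-injective m'≤m m'≤m _ _ (g-inj e)) , g-iso ∘ shrink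
    where
    shrink : Fin _ → Fin _
    shrink z = inject≤ z m'≤m

  Reduced⇒ReducedHeight≤ : ∀ {f ℓ} {t : Tree k} → f Preserves _≤_ ⟶ _≤_ → height t ≤ ℓ →
    Reduced f t → ReducedHeight≤ f ℓ t
  Reduced⇒ReducedHeight≤ f-mono h≤ℓ red = h≤ℓ , λ d L cs at j many →
    red d L cs at j (AtLeastOtherIsoLimbs-weaken cs j (f-mono (∸-monoˡ-≤ 1 (∸-monoˡ-≤ d h≤ℓ))) many)

  ReducedHeight≤-suc : ∀ {f ℓ} (t : Tree k) → ReducedHeight≤ f (suc ℓ) t →
    AllLimbs (ReducedHeight≤ f ℓ) t × FewIsoLimbs (f ℓ) t
  ReducedHeight≤-suc (node L cs) (h , red) =
    (λ x → heightList-limb cs h x , λ d L' cs' at → red (suc d) L' cs' (there x at)) , red 0 L cs here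

  ReducedHeight≤-zero : ∀ {f} (t : Tree k) → ReducedHeight≤ f 0 t → AllLimbs (λ _ → ⊥) t × FewIsoLimbs 0 t
  ReducedHeight≤-zero (node L [])      _       = (λ ()) , λ ()
  ReducedHeight≤-zero (node L (c ∷ cs)) (h , _) with m⊔n≤o⇒m≤o (suc (height c)) (heightList cs) h
  ... | ()

  AtMostNonIso-⊥ : AtMostNonIso 0 (λ _ → ⊥)
  AtMostNonIso-⊥ []      _            = z≤n
  AtMostNonIso-⊥ (_ ∷ _) ((() ∷ _) , _)

-- At height 0 the signature bound is used with no limb types at all, leaving the 2^k root labels.
ReducedHeight≤-bound : ∀ {k} i q s → AtMostNonIso {k} (N i q s k) (ReducedHeight≤ (λ j → R j q s k) i)
ReducedHeight≤-bound {k} zero q s =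
  AtMostNonIso-mono (≤-trans (≤-reflexive (*-identityʳ (2 ^ k))) (m≤m+n (2 ^ k) 1))
    (ReducedHeight≤-zero {f = λ j → R j q s k} _) (signature-bound {r = 0} AtMostNonIso-⊥)
ReducedHeight≤-bound {k} (suc i) q s =
  AtMostNonIso-mono (≤-reflexive (cong (λ x → 2 ^ k * x ^ N i q s k) (+-comm 1 (R i q s k))))
    (ReducedHeight≤-suc {f = λ j → R j q s k} _) (signature-bound (ReducedHeight≤-bound i q s))

lemma2 : (i q s k : ℕ) (ts : List (Tree k)) →
    All (λ t → (height t ≤ i) × Reduced (λ j → R j q s k) t) ts →
    (∀ (a b : Fin (length ts)) → a ≢ b → ¬ (lookup ts a ≅ lookup ts b)) →
    length ts ≤ N i q s k
lemma2 i q s k ts hyps pw = ReducedHeight≤-bound i q s ts (All.map weaken hyps , pw)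
  where
  weaken : ∀ {t} → height t ≤ i × Reduced (λ j → R j q s k) t → ReducedHeight≤ (λ j → R j q s k) i t
  weaken {t} (h , red) = Reduced⇒ReducedHeight≤ {t = t} (R-mono q s k) h red
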